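{- Let $k\geq 2$ and $n,m$ be positive integers. Let $G$ be a finite simple graph with $n^2$ vertices and $O\chi_k(G)=n$, and let $H$ be a finite simple graph with $m^2$ vertices and $O\chi_k(H)=m$. Then $O\chi_k(G\,\square\, H)=nm$ and $O\chi_k(G\boxtimes H)=nm$.
   Context: Two vertex colourings $c,c'$ of a graph are orthogonal if no two distinct vertices $u\neq v$ satisfy both $c(u)=c(v)$ and $c'(u)=c'(v)$. A $k$-orthogonal colouring of a graph is a collection of $k$ proper vertex colourings that are pairwise orthogonal. The $k$-orthogonal chromatic number $O\chi_k(G)$ is the minimum $N$ such that $G$ has a $k$-orthogonal colouring in which every colouring uses colours from a set of $N$ colours. The Cartesian product $G\,\square\,H$ has vertex set $V(G)\times V(H)$, with $(u_1,v_1)$ adjacent to $(u_2,v_2)$ if and only if either $u_1=u_2$ and $v_1v_2\in E(H)$, or $v_1=v_2$ and $u_1u_2\in E(G)$. The tensor product $G\times H$ has vertex set $V(G)\times V(H)$, with $(u_1,v_1)$ adjacent to $(u_2,v_2)$ iff $u_1u_2\in E(G)$ and $v_1v_2\in E(H)$. The strong product $G\boxtimes H$ has vertex set $V(G)\times V(H)$ and edge set $E(G\,\square\,H)\cup E(G\times H)$. -}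

module Defs where

open import Data.Nat using (ℕ; _≤_)
open import Data.Fin using (Fin)
open import Data.Product using (_×_; _,_; Σ)
open import Data.Sum using (_⊎_)
open import Relation.Binary.PropositionalEquality using (_≡_; _≢_)
open import Relation.Nullary using (¬_)
open import Data.Empty using (⊥)

record Graph (V : Set) : Set₁ where
  field
    Adj    : V → V → Set
    sym    : ∀ {u v} → Adj u v → Adj v u
    irrefl : ∀ {v} → ¬ Adj v v
open Graph public

Colouring : Set → ℕ → Set
Colouring V N = V → Fin N

Proper : ∀ {V} → Graph V → ∀ {N} → Colouring V N → Set
Proper G c = ∀ u v → Adj G u v → c u ≢ c v

Orthogonal : ∀ {V N} → Colouring V N → Colouring V N → Set
Orthogonal c c' = ∀ u v → u ≢ v → c u ≡ c v → c' u ≡ c' v → ⊥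

record OrthColouring {V : Set} (k : ℕ) (G : Graph V) (N : ℕ) : Set where
  field
    col    : Fin k → Colouring V N
    proper : ∀ i → Proper G (col i)
    orth   : ∀ i j → i ≢ j → Orthogonal (col i) (col j)

IsOχ : ∀ {V} → ℕ → Graph V → ℕ → Set
IsOχ k G n = OrthColouring k G n × (∀ N → OrthColouring k G N → n ≤ N)

_□_ : ∀ {V W} → Graph V → Graph W → Graph (V × W)
Adj (G □ H) (u₁ , v₁) (u₂ , v₂) =
  (u₁ ≡ u₂ × Adj H v₁ v₂) ⊎ (v₁ ≡ v₂ × Adj G u₁ u₂)
Graph.sym (G □ H) (Data.Sum.inj₁ (e , a)) = Data.Sum.inj₁ (Relation.Binary.PropositionalEquality.sym e , Graph.sym H a)
Graph.sym (G □ H) (Data.Sum.inj₂ (e , a)) = Data.Sum.inj₂ (Relation.Binary.PropositionalEquality.sym e , Graph.sym G a)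
irrefl (G □ H) (Data.Sum.inj₁ (_ , a)) = irrefl H a
irrefl (G □ H) (Data.Sum.inj₂ (_ , a)) = irrefl G a

TensorAdj : ∀ {V W} → Graph V → Graph W → V × W → V × W → Set
TensorAdj G H (u₁ , v₁) (u₂ , v₂) = Adj G u₁ u₂ × Adj H v₁ v₂

_⊠_ : ∀ {V W} → Graph V → Graph W → Graph (V × W)
Adj (G ⊠ H) x y = Adj (G □ H) x y ⊎ TensorAdj G H x y
Graph.sym (G ⊠ H) (Data.Sum.inj₁ a) = Data.Sum.inj₁ (Graph.sym (G □ H) a)
Graph.sym (G ⊠ H) (Data.Sum.inj₂ (a , b)) = Data.Sum.inj₂ (Graph.sym G a , Graph.sym H b)
irrefl (G ⊠ H) (Data.Sum.inj₁ a) = irrefl (G □ H) a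
irrefl (G ⊠ H) (Data.Sum.inj₂ (a , _)) = irrefl G a

-- Two orthogonal colourings c, c' with N colours make v ↦ (c v, c' v) injective, so a graph with a
-- k-orthogonal colouring (k ≥ 2) on N colours has at most N² vertices; G □ H and G ⊠ H have (nm)²
-- vertices, so they need at least nm colours. Conversely, colouring (u, v) by the pair of the i-th
-- colours of u and v is a k-orthogonal colouring of G ⊠ H, hence of its spanning subgraph G □ H,
-- with nm colours.
module Submission where

open import Defs
open import Data.Nat using (ℕ; _*_; _≤_; suc; s≤s; _≤?_)
open import Data.Nat.Properties using (*-mono-<; <⇒≱; ≰⇒>; [m*n]*[o*p]≡[m*o]*[n*p])
open import Data.Fin using (Fin; zero; suc; combine; _≟_)
open import Data.Fin.Properties using (combine-injective; injective⇒≤; *↔×)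
open import Data.Product using (_×_; _,_; <_,_>; uncurry)
open import Data.Product.Properties using (≡-dec; ,-injectiveˡ; ,-injectiveʳ)
open import Data.Sum using (_⊎_; inj₁; inj₂)
open import Data.Empty using (⊥-elim)
open import Function using (_∘_; _↣_; Injection)
open import Function.Definitions using (Injective)
open import Function.Properties.Inverse using (↔⇒↣)
open import Relation.Binary using (DecidableEquality)
open import Relation.Binary.PropositionalEquality using (_≡_; refl; cong; subst)
open import Relation.Nullary using (yes; no)

open OrthColouring

private
  variable
    V W : Set
    a b k n m N : ℕ

pairing-injective : DecidableEquality V → {c c' : Colouring V N} →
  Orthogonal c c' → Injective _≡_ _≡_ < c , c' >
pairing-injective _≟ᵥ_ c⊥c' {u} {v} eq with u ≟ᵥ v
... | yes u≡v = u≡v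
... | no  u≢v = ⊥-elim (c⊥c' u v u≢v (,-injectiveˡ eq) (,-injectiveʳ eq))

combine-injective₂ : Injective _≡_ _≡_ (uncurry (combine {a} {b}))
combine-injective₂ {x = i , j} {y = k , l} eq with combine-injective i j k l eq
... | refl , refl = refl

order≤colours² : {Γ : Graph V} → DecidableEquality V → Fin n ↣ V →
  2 ≤ k → OrthColouring k Γ N → n ≤ N * N
order≤colours² {k = suc (suc _)} _≟ᵥ_ e (s≤s (s≤s _)) C =
  injective⇒≤ (λ eq → injective (pairing-injective _≟ᵥ_ (orth C zero (suc zero) λ ())
                                   (combine-injective₂ eq)))
  where open Injection e

m*m≤n*n⇒m≤n : ∀ m n → m * m ≤ n * n → m ≤ n
m*m≤n*n⇒m≤n m n m²≤n² with m ≤? n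
... | yes m≤n = m≤n
... | no  m≰n = ⊥-elim (<⇒≱ (*-mono-< (≰⇒> m≰n) (≰⇒> m≰n)) m²≤n²)

product-colours≥ : {Γ : Graph (Fin (n * n) × Fin (m * m))} →
  2 ≤ k → OrthColouring k Γ N → n * m ≤ N
product-colours≥ {n} {m} {N = N} 2≤k C =
  m*m≤n*n⇒m≤n (n * m) N
    (subst (_≤ N * N) ([m*n]*[o*p]≡[m*o]*[n*p] n n m m)
      (order≤colours² (≡-dec _≟_ _≟_) (↔⇒↣ *↔×) 2≤k C))

⊠-adj⇒factor-adj : {G : Graph V} {H : Graph W} → ∀ {u₁ v₁ u₂ v₂} →
  Adj (G ⊠ H) (u₁ , v₁) (u₂ , v₂) → Adj G u₁ u₂ ⊎ Adj H v₁ v₂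
⊠-adj⇒factor-adj (inj₁ (inj₁ (_ , h))) = inj₂ h
⊠-adj⇒factor-adj (inj₁ (inj₂ (_ , g))) = inj₁ g
⊠-adj⇒factor-adj (inj₂ (g , _))        = inj₁ g

⊠-orthColouring : (G : Graph (Fin a)) (H : Graph W) →
  OrthColouring k G n → OrthColouring k H m → OrthColouring k (G ⊠ H) (n * m)
col (⊠-orthColouring G H C D) i (u , v) = combine (col C i u) (col D i v)
proper (⊠-orthColouring G H C D) i (u₁ , v₁) (u₂ , v₂) adj eq
  with combine-injective (col C i u₁) (col D i v₁) (col C i u₂) (col D i v₂) eq
     | ⊠-adj⇒factor-adj {G = G} {H} adj
... | cu₁≡cu₂ , _ | inj₁ g = proper C i u₁ u₂ g cu₁≡cu₂
... | _ , dv₁≡dv₂ | inj₂ h = proper D i v₁ v₂ h dv₁≡dv₂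
orth (⊠-orthColouring G H C D) i j i≢j (u₁ , v₁) (u₂ , v₂) p₁≢p₂ eqᵢ eqⱼ
  with combine-injective (col C i u₁) (col D i v₁) (col C i u₂) (col D i v₂) eqᵢ
     | combine-injective (col C j u₁) (col D j v₁) (col C j u₂) (col D j v₂) eqⱼ
     | u₁ ≟ u₂
... | cᵢ , _  | cⱼ , _  | no u₁≢u₂ = orth C i j i≢j u₁ u₂ u₁≢u₂ cᵢ cⱼ
... | _  , dᵢ | _  , dⱼ | yes refl = orth D i j i≢j v₁ v₂ (p₁≢p₂ ∘ cong (u₁ ,_)) dᵢ dⱼ

orthColouring-spanningSubgraph : {Γ Δ : Graph V} → (∀ {x y} → Adj Γ x y → Adj Δ x y) →
  OrthColouring k Δ N → OrthColouring k Γ N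
col (orthColouring-spanningSubgraph Γ⊆Δ C) = col C
proper (orthColouring-spanningSubgraph Γ⊆Δ C) i u v = proper C i u v ∘ Γ⊆Δ
orth (orthColouring-spanningSubgraph Γ⊆Δ C) = orth C

mainTheorem5 : (k n m : ℕ) → 2 ≤ k → 1 ≤ n → 1 ≤ m →
    (G : Graph (Fin (n * n))) → (H : Graph (Fin (m * m))) →
    IsOχ k G n → IsOχ k H m →
    IsOχ k (G □ H) (n * m) × IsOχ k (G ⊠ H) (n * m)
mainTheorem5 k n m 2≤k _ _ G H (C , _) (D , _) =
  (orthColouring-spanningSubgraph inj₁ G⊠H-colouring , λ _ → product-colours≥ {n} {m} 2≤k) ,
  (G⊠H-colouring , λ _ → product-colours≥ {n} {m} 2≤k)
  where
  G⊠H-colouring : OrthColouring k (G ⊠ H) (n * m)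
  G⊠H-colouring = ⊠-orthColouring G H C D
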